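{- Let $d\ge2$ and $k>p\ge1$ be integers, and let $\mathbb{P}_k^{(d)}$ be the uniform probability measure on $\mathcal{C}_k^{(d)}$. Then the $\mathbb{P}_k^{(d)}$-probability that there is at most one internal vertex in each of the generations $1$ through $p$ of the tree is at least $e^{ -p}$.
   Context: A $d$-Catalan tree is a rooted planar tree in which every vertex has either $0$ or $d$ children; $\mathcal{C}_k^{(d)}$ denotes the set of such trees with $k$ internal vertices. Generation $j$ of a tree is the set of vertices at graph distance $j$ from the root. -}

module Defs where

open import Data.Nat using (ℕ; zero; suc; _+_; _*_; _^_; _≤_; _≤?_)
open import Data.Vec using (Vec; []; _∷_)
open import Data.List using (List; []; _∷_; map; concatMap; filter; length; upTo)
open import Data.List.Relation.Unary.All using (All; all?)
import Relation.Nullary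
import Data.Nat

-- d-ary planar rooted trees: every vertex has 0 or d (ordered) children.
data Tree (d : ℕ) : Set where
  leaf : Tree d
  node : Vec (Tree d) d → Tree d

mutual
  internal : ∀ {d} → Tree d → ℕ
  internal leaf      = 0
  internal (node ts) = suc (internalV ts)

  internalV : ∀ {d n} → Vec (Tree d) n → ℕ
  internalV []       = 0
  internalV (t ∷ ts) = internal t + internalV ts

mutual
  genInternal : ∀ {d} → ℕ → Tree d → ℕ
  genInternal j       leaf      = 0
  genInternal zero    (node ts) = 1
  genInternal (suc j) (node ts) = genInternalV j ts

  genInternalV : ∀ {d n} → ℕ → Vec (Tree d) n → ℕ
  genInternalV j []       = 0
  genInternalV j (t ∷ ts) = genInternal j t + genInternalV j ts

allVecs : ∀ {A : Set} (n : ℕ) → List A → List (Vec A n)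
allVecs zero    xs = [] ∷ []
allVecs (suc n) xs = concatMap (λ x → map (x ∷_) (allVecs n xs)) xs

allTrees : (d h : ℕ) → List (Tree d)
allTrees d zero    = leaf ∷ []
allTrees d (suc h) = leaf ∷ map node (allVecs d (allTrees d h))

-- C_k^{(d)} as a list: a tree with k internal vertices has height ≤ k
catalan : (d k : ℕ) → List (Tree d)
catalan d k = filter (λ t → internal t Data.Nat.≟ k) (allTrees d k)

Good : ∀ {d} → ℕ → Tree d → Set
Good p t = All (λ j → genInternal j t ≤ 1) (map suc (upTo p))

good? : ∀ {d} (p : ℕ) (t : Tree d) → Relation.Nullary.Dec (Good p t)
good? p t = all? (λ j → genInternal j t ≤? 1) (map suc (upTo p))

-- expNum p N = N! * Σ_{n=0}^{N} p^n / n!   (a natural number)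
expNum : ℕ → ℕ → ℕ
expNum p zero    = 1
expNum p (suc N) = suc N * expNum p N + p ^ suc N

module Submission where

-- Write d = m + 1 and C_j = fussCatalan d j = (dj)! / (j! (mj + 1)!). The trees whose internal
-- vertices in generations 0, …, p form a single path are good, and there are d^p C_(k-p) of them.
-- The closed form gives C_(j+1) m^m ≤ d^d C_j, so C_k m^(mp) ≤ d^(dp) C_(k-p), and the good
-- fraction is at least (m / d)^N with N = mp. Finally (1 + 1/m)^N ≤ Σ_(j ≤ N) p^j / j! = expNum p N / N!,
-- comparing the binomial terms termwise: C(N, j) m^(-j) ≤ N^j / (j! m^j) = p^j / j!.

open import Defs
open import Data.Nat using (ℕ; zero; suc; _+_; _*_; _^_; _∸_; _≤_; _<_; _!; z≤n; s≤s; NonZero; _≟_)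
open import Data.Nat.Properties
open import Data.Nat.Combinatorics using (_C_; nCk+nC[k+1]≡[n+1]C[k+1]; k>n⇒nCk≡0)
open import Data.Nat.Tactic.RingSolver using (solve-∀)
open import Algebra.Properties.CommutativeSemigroup *-commutativeSemigroup using (x∙yz≈y∙xz)
open import Data.Empty using (⊥-elim)
open import Data.Fin using (Fin; zero; suc)
open import Data.List using (List; []; _∷_; _++_; map; length; filter; concatMap; cartesianProductWith; allFin; upTo)
open import Data.List.Properties using (length-map; length-++; length-removeAt′; length-tabulate)
open import Data.List.Membership.Propositional using (_∈_)
open import Data.List.Membership.Propositional.Properties
open import Data.List.Relation.Binary.Subset.Propositional using (_⊆_)
open import Data.List.Relation.Unary.Any using (here; there; index; _─_)
open import Data.List.Relation.Unary.All as All using (All; []; _∷_)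
import Data.List.Relation.Unary.All.Properties as Allₚ
open import Data.List.Relation.Unary.AllPairs using ([]; _∷_)
open import Data.List.Relation.Unary.Unique.Propositional using (Unique)
import Data.List.Relation.Unary.Unique.Propositional.Properties as Uniqueₚ
open import Data.Vec as Vec using (Vec; []; _∷_; take; drop) renaming (_++_ to _++ᵛ_)
import Data.Vec.Properties as Vecₚ
open import Data.Vec.Relation.Unary.All using ([]; _∷_) renaming (All to VecAll)
open import Data.Product as Product using (∃; _×_; _,_; proj₂)
open import Relation.Nullary using (¬_)
open import Relation.Binary.PropositionalEquality

-- horner N f x = Σ_{j ≤ N} f j * x ^ (N ∸ j)
horner : ℕ → (ℕ → ℕ) → ℕ → ℕ
horner zero    f x = f 0
horner (suc N) f x = x * horner N f x + f (suc N)

horner-cong : ∀ N {f g} x → (∀ j → j ≤ N → f j ≡ g j) → horner N f x ≡ horner N g x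
horner-cong zero    x f≡g = f≡g 0 z≤n
horner-cong (suc N) x f≡g =
  cong₂ (λ a b → x * a + b) (horner-cong N x (λ j j≤N → f≡g j (m≤n⇒m≤1+n j≤N))) (f≡g (suc N) ≤-refl)

horner-mono-≤ : ∀ N {f g} x → (∀ j → j ≤ N → f j ≤ g j) → horner N f x ≤ horner N g x
horner-mono-≤ zero    x f≤g = f≤g 0 z≤n
horner-mono-≤ (suc N) x f≤g =
  +-mono-≤ (*-monoʳ-≤ x (horner-mono-≤ N x (λ j j≤N → f≤g j (m≤n⇒m≤1+n j≤N)))) (f≤g (suc N) ≤-refl)

horner-*ˡ : ∀ N c f x → horner N (λ j → c * f j) x ≡ c * horner N f x
horner-*ˡ zero    c f x = refl
horner-*ˡ (suc N) c f x rewrite horner-*ˡ N c f x = factorˡ x c (horner N f x) (f (suc N))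
  where
  factorˡ : ∀ x c h a → x * (c * h) + c * a ≡ c * (x * h + a)
  factorˡ = solve-∀

horner-+ : ∀ N f g x → horner N (λ j → f j + g j) x ≡ horner N f x + horner N g x
horner-+ zero    f g x = refl
horner-+ (suc N) f g x rewrite horner-+ N f g x =
  interchange x (horner N f x) (horner N g x) (f (suc N)) (g (suc N))
  where
  interchange : ∀ x a b c d → x * (a + b) + (c + d) ≡ (x * a + c) + (x * b + d)
  interchange = solve-∀

shift : (ℕ → ℕ) → ℕ → ℕ
shift f zero    = 0
shift f (suc j) = f j

horner-shift : ∀ N f x → horner (suc N) (shift f) x ≡ horner N f x
horner-shift zero    f x = cong (_+ f 0) (*-zeroʳ x)
horner-shift (suc N) f x = cong (λ h → x * h + f (suc N)) (horner-shift N f x)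

binomial-theorem : ∀ N x → suc x ^ N ≡ horner N (N C_) x
binomial-theorem zero    x = refl
binomial-theorem (suc N) x = begin
  suc x * suc x ^ N                                      ≡⟨ cong (suc x *_) (binomial-theorem N x) ⟩
  suc x * h                                              ≡⟨ expand x h ⟩
  (x * h + 0) + h                                        ≡⟨ cong₂ (λ c s → (x * h + c) + s) (k>n⇒nCk≡0 (n<1+n N)) (horner-shift N (N C_) x) ⟨
  horner (suc N) (N C_) x + horner (suc N) (shift (N C_)) x ≡⟨ horner-+ (suc N) (N C_) (shift (N C_)) x ⟨
  horner (suc N) (λ j → N C j + shift (N C_) j) x       ≡⟨ horner-cong (suc N) x (λ j _ → pascal j) ⟩
  horner (suc N) (suc N C_) x                            ∎
  where
  open ≡-Reasoning
  h = horner N (N C_) x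
  expand : ∀ x h → suc x * h ≡ (x * h + 0) + h
  expand = solve-∀
  pascal : ∀ j → N C j + shift (N C_) j ≡ suc N C j
  pascal zero    = refl
  pascal (suc j) = trans (+-comm (N C suc j) (N C j)) (nCk+nC[k+1]≡[n+1]C[k+1] N j)

falling : ℕ → ℕ → ℕ
falling n       zero    = 1
falling zero    (suc k) = 0
falling (suc n) (suc k) = suc n * falling n k

falling-pascal : ∀ n k → falling (suc n) (suc k) ≡ falling n (suc k) + suc k * falling n k
falling-pascal zero    zero    = refl
falling-pascal zero    (suc k) = sym (*-zeroʳ (suc (suc k)))
falling-pascal (suc n) zero    = split-one n
  where
  split-one : ∀ n → suc (suc n) * 1 ≡ suc n * 1 + 1 * 1
  split-one = solve-∀
falling-pascal (suc n) (suc k) = begin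
  suc (suc n) * (suc n * b)            ≡⟨ peel n b ⟩
  suc n * (suc n * b) + suc n * b      ≡⟨ cong (λ z → suc n * z + suc n * b) (falling-pascal n k) ⟩
  suc n * (a + suc k * b) + suc n * b  ≡⟨ regroup n k a b ⟩
  suc n * a + suc (suc k) * (suc n * b) ∎
  where
  open ≡-Reasoning
  a = falling n (suc k)
  b = falling n k
  peel : ∀ n b → suc (suc n) * (suc n * b) ≡ suc n * (suc n * b) + suc n * b
  peel = solve-∀
  regroup : ∀ n k a b → suc n * (a + suc k * b) + suc n * b ≡ suc n * a + suc (suc k) * (suc n * b)
  regroup = solve-∀

nCk*k!≡falling : ∀ n k → (n C k) * k ! ≡ falling n k
nCk*k!≡falling n       zero    = refl
nCk*k!≡falling zero    (suc k) = cong (_* suc k !) (k>n⇒nCk≡0 {0} {suc k} (s≤s z≤n))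
nCk*k!≡falling (suc n) (suc k) = begin
  (suc n C suc k) * (suc k * k !)                       ≡⟨ cong (_* (suc k * k !)) (nCk+nC[k+1]≡[n+1]C[k+1] n k) ⟨
  (n C k + n C suc k) * (suc k * k !)                   ≡⟨ distrib (n C k) (n C suc k) k (k !) ⟩
  suc k * ((n C k) * k !) + (n C suc k) * (suc k * k !) ≡⟨ cong₂ (λ a b → suc k * a + b) (nCk*k!≡falling n k) (nCk*k!≡falling n (suc k)) ⟩
  suc k * falling n k + falling n (suc k)               ≡⟨ +-comm (suc k * falling n k) _ ⟩
  falling n (suc k) + suc k * falling n k               ≡⟨ falling-pascal n k ⟨
  falling (suc n) (suc k)                               ∎
  where
  open ≡-Reasoning
  distrib : ∀ a b k f → (a + b) * (suc k * f) ≡ suc k * (a * f) + b * (suc k * f)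
  distrib = solve-∀

falling≤^ : ∀ n k → falling n k ≤ n ^ k
falling≤^ n       zero    = ≤-refl
falling≤^ zero    (suc k) = z≤n
falling≤^ (suc n) (suc k) = *-monoʳ-≤ (suc n) (≤-trans (falling≤^ n k) (^-monoˡ-≤ k (n≤1+n n)))

falling*[n∸k]!≡n! : ∀ {n k} → k ≤ n → falling n k * (n ∸ k) ! ≡ n !
falling*[n∸k]!≡n! {n} z≤n = *-identityˡ (n !)
falling*[n∸k]!≡n! {suc n} {suc k} (s≤s k≤n) =
  trans (*-assoc (suc n) (falling n k) _) (cong (suc n *_) (falling*[n∸k]!≡n! k≤n))

falling-suc : ∀ {n k} → k ≤ n → falling (suc n) (suc n ∸ k) ≡ suc n * falling n (n ∸ k)
falling-suc {n} {k} k≤n rewrite +-∸-assoc 1 k≤n = refl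

^-distribʳ-* : ∀ a b n → (a * b) ^ n ≡ a ^ n * b ^ n
^-distribʳ-* a b zero    = refl
^-distribʳ-* a b (suc n) rewrite ^-distribʳ-* a b n = interchange a b (a ^ n) (b ^ n)
  where
  interchange : ∀ a b x y → a * b * (x * y) ≡ a * x * (b * y)
  interchange = solve-∀

-- N! / j! = falling N (N ∸ j)
m^N*expNum≡horner : ∀ m p N → m ^ N * expNum p N ≡ horner N (λ j → (m * p) ^ j * falling N (N ∸ j)) m
m^N*expNum≡horner m p zero    = refl
m^N*expNum≡horner m p (suc N) = begin
  m * m ^ N * (suc N * expNum p N + p * p ^ N)            ≡⟨ expand m (m ^ N) (expNum p N) N (p ^ N) p ⟩
  m * (suc N * (m ^ N * expNum p N)) + m * m ^ N * (p * p ^ N) * 1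
    ≡⟨ cong₂ (λ a b → m * (suc N * a) + b) (m^N*expNum≡horner m p N) last-term ⟩
  m * (suc N * horner N term m) + term′ (suc N)            ≡⟨ cong (λ h → m * h + term′ (suc N)) (horner-*ˡ N (suc N) term m) ⟨
  m * horner N (λ j → suc N * term j) m + term′ (suc N)   ≡⟨ cong (λ h → m * h + term′ (suc N)) (horner-cong N m term-suc) ⟩
  m * horner N term′ m + term′ (suc N)                    ∎
  where
  open ≡-Reasoning
  term term′ : ℕ → ℕ
  term  j = (m * p) ^ j * falling N (N ∸ j)
  term′ j = (m * p) ^ j * falling (suc N) (suc N ∸ j)
  expand : ∀ m M E N P p → m * M * (suc N * E + p * P) ≡ m * (suc N * (M * E)) + m * M * (p * P) * 1
  expand = solve-∀
  last-term : m * m ^ N * (p * p ^ N) * 1 ≡ term′ (suc N)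
  last-term = cong₂ _*_ (sym (^-distribʳ-* m p (suc N))) (cong (falling (suc N)) (sym (n∸n≡0 N)))
  term-suc : ∀ j → j ≤ N → suc N * term j ≡ term′ j
  term-suc j j≤N = begin
    suc N * ((m * p) ^ j * falling N (N ∸ j))  ≡⟨ x∙yz≈y∙xz (suc N) ((m * p) ^ j) _ ⟩
    (m * p) ^ j * (suc N * falling N (N ∸ j))  ≡⟨ cong ((m * p) ^ j *_) (falling-suc j≤N) ⟨
    term′ j                                    ∎

N!≡falling*j! : ∀ {N j} → j ≤ N → N ! ≡ falling N (N ∸ j) * j !
N!≡falling*j! {N} {j} j≤N = begin
  N !                                      ≡⟨ falling*[n∸k]!≡n! (m∸n≤m N j) ⟨
  falling N (N ∸ j) * (N ∸ (N ∸ j)) !      ≡⟨ cong (λ i → falling N (N ∸ j) * i !) (m∸[m∸n]≡n j≤N) ⟩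
  falling N (N ∸ j) * j !                  ∎
  where open ≡-Reasoning

[1+x]^N*N!≤horner : ∀ N x → suc x ^ N * N ! ≤ horner N (λ j → N ^ j * falling N (N ∸ j)) x
[1+x]^N*N!≤horner N x = begin
  suc x ^ N * N !                         ≡⟨ cong (_* N !) (binomial-theorem N x) ⟩
  horner N (N C_) x * N !                 ≡⟨ *-comm _ (N !) ⟩
  N ! * horner N (N C_) x                 ≡⟨ horner-*ˡ N (N !) (N C_) x ⟨
  horner N (λ j → N ! * (N C j)) x        ≤⟨ horner-mono-≤ N x term-bound ⟩
  horner N (λ j → N ^ j * falling N (N ∸ j)) x ∎
  where
  open ≤-Reasoning
  term-bound : ∀ j → j ≤ N → N ! * (N C j) ≤ N ^ j * falling N (N ∸ j)
  term-bound j j≤N = begin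
    N ! * (N C j)                         ≡⟨ cong (_* (N C j)) (N!≡falling*j! j≤N) ⟩
    falling N (N ∸ j) * j ! * (N C j)     ≡⟨ reassoc (falling N (N ∸ j)) (j !) (N C j) ⟩
    falling N (N ∸ j) * ((N C j) * j !)   ≡⟨ cong (falling N (N ∸ j) *_) (nCk*k!≡falling N j) ⟩
    falling N (N ∸ j) * falling N j       ≤⟨ *-monoʳ-≤ (falling N (N ∸ j)) (falling≤^ N j) ⟩
    falling N (N ∸ j) * N ^ j             ≡⟨ *-comm (falling N (N ∸ j)) (N ^ j) ⟩
    N ^ j * falling N (N ∸ j)             ∎
    where
    reassoc : ∀ a b c → a * b * c ≡ a * (c * b)
    reassoc = solve-∀

[1+m]^N*N!≤m^N*expNum : ∀ m p → let N = m * p in suc m ^ N * N ! ≤ m ^ N * expNum p N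
[1+m]^N*N!≤m^N*expNum m p =
  ≤-trans ([1+x]^N*N!≤horner (m * p) m) (≤-reflexive (sym (m^N*expNum≡horner m p (m * p))))

-- forests d n j counts sequences of n d-ary trees with j internal vertices in total:
-- either the first tree is a leaf, or it is replaced by its d subtrees.
forests : ℕ → ℕ → ℕ → ℕ
forests d zero    zero    = 1
forests d zero    (suc j) = 0
forests d (suc n) zero    = forests d n zero
forests d (suc n) (suc j) = forests d n (suc j) + forests d (d + n) j

fussCatalan : ℕ → ℕ → ℕ
fussCatalan d = forests d 1

forests-zero : ∀ d n → forests d n 0 ≡ 1
forests-zero d zero    = refl
forests-zero d (suc n) = forests-zero d n

fussCatalan-suc : ∀ d j → fussCatalan d (suc j) ≡ forests d d j
fussCatalan-suc d j = cong (λ n → forests d n j) (+-identityʳ d)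

-- The cycle lemma, cleared of denominators.
forests-closedForm : ∀ m j n → forests (suc m) (suc n) j * (j ! * (m * j + suc n) !) ≡ suc n * (suc m * j + n) !
forests-closedForm m zero n rewrite forests-zero (suc m) n | *-zeroʳ m = simplify n (n !)
  where
  simplify : ∀ n x → 1 * (1 * (suc n * x)) ≡ suc n * x
  simplify = solve-∀
forests-closedForm m (suc j) zero = begin
  F * (suc j ! * (m * suc j + 1) !)      ≡⟨ cong (λ i → F * (suc j ! * i !)) (index₁ m j) ⟩
  F * (suc j ! * (m * j + suc m) !)      ≡⟨ reassoc F j (j !) ((m * j + suc m) !) ⟩
  suc j * (F * (j ! * (m * j + suc m) !)) ≡⟨ cong (suc j *_) ih ⟩
  suc j * (suc m * (suc m * j + m) !)   ≡⟨ collect m j ((suc m * j + m) !) ⟩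
  suc (suc m * j + m) !                 ≡⟨ cong _! (index₂ m j) ⟨
  (suc m * suc j + 0) !                 ≡⟨ *-identityˡ _ ⟨
  1 * (suc m * suc j + 0) !             ∎
  where
  open ≡-Reasoning
  F = forests (suc m) (suc m + 0) j
  ih : F * (j ! * (m * j + suc m) !) ≡ suc m * (suc m * j + m) !
  ih = subst (λ n → forests (suc m) n j * (j ! * (m * j + suc m) !) ≡ suc m * (suc m * j + m) !)
             (sym (+-identityʳ (suc m))) (forests-closedForm m j m)
  index₁ : ∀ m j → m * suc j + 1 ≡ m * j + suc m
  index₁ = solve-∀
  index₂ : ∀ m j → suc m * suc j + 0 ≡ suc (suc m * j + m)
  index₂ = solve-∀
  reassoc : ∀ F j X Y → F * (suc j * X * Y) ≡ suc j * (F * (X * Y))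
  reassoc = solve-∀
  collect : ∀ m j Z → suc j * (suc m * Z) ≡ suc (suc m * j + m) * Z
  collect = solve-∀
forests-closedForm m (suc j) (suc n) = begin
  (F₁ + F₂) * (suc j ! * (m * suc j + suc (suc n)) !)
    ≡⟨ cong (λ i → (F₁ + F₂) * (suc j ! * i !)) (+-suc (m * suc j) (suc n)) ⟩
  (F₁ + F₂) * (suc j ! * suc Y !)
    ≡⟨ split F₁ F₂ j (j !) Y (Y !) ⟩
  suc Y * (F₁ * (suc j ! * Y !)) + suc j * (F₂ * (j ! * suc Y !))
    ≡⟨ cong (λ i → suc Y * (F₁ * (suc j ! * Y !)) + suc j * (F₂ * (j ! * i !))) (index₂ m j n) ⟨
  suc Y * (F₁ * (suc j ! * Y !)) + suc j * (F₂ * (j ! * (m * j + suc (m + suc n)) !))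
    ≡⟨ cong₂ (λ a b → suc Y * a + suc j * b) (forests-closedForm m (suc j) n) (forests-closedForm m j (m + suc n)) ⟩
  suc Y * (suc n * (suc m * suc j + n) !) + suc j * (suc (m + suc n) * K !)
    ≡⟨ cong (λ i → suc Y * (suc n * i !) + suc j * (suc (m + suc n) * K !)) (index₁ m j n) ⟩
  suc Y * (suc n * K !) + suc j * (suc (m + suc n) * K !)
    ≡⟨ collect m j n (K !) ⟩
  suc (suc n) * suc K !
    ≡⟨ cong (λ i → suc (suc n) * i !) (index₃ m j n) ⟨
  suc (suc n) * (suc m * suc j + suc n) !
    ∎
  where
  open ≡-Reasoning
  F₁ = forests (suc m) (suc n) (suc j)
  F₂ = forests (suc m) (suc (m + suc n)) j
  Y = m * suc j + suc n
  K = suc m * j + (m + suc n)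
  index₁ : ∀ m j n → suc m * suc j + n ≡ suc m * j + (m + suc n)
  index₁ = solve-∀
  index₂ : ∀ m j n → m * j + suc (m + suc n) ≡ suc (m * suc j + suc n)
  index₂ = solve-∀
  index₃ : ∀ m j n → suc m * suc j + suc n ≡ suc (suc m * j + (m + suc n))
  index₃ = solve-∀
  split : ∀ F₁ F₂ j X Y Z → (F₁ + F₂) * (suc j * X * (suc Y * Z)) ≡ suc Y * (F₁ * (suc j * X * Z)) + suc j * (F₂ * (X * (suc Y * Z)))
  split = solve-∀
  collect : ∀ m j n V → suc (m * suc j + suc n) * (suc n * V) + suc j * (suc (m + suc n) * V) ≡ suc (suc n) * (suc (suc m * j + (m + suc n)) * V)
  collect = solve-∀

fussCatalan-closedForm : ∀ m j → fussCatalan (suc m) j * (j ! * (m * j + 1) !) ≡ (suc m * j) !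
fussCatalan-closedForm m j = begin
  fussCatalan (suc m) j * (j ! * (m * j + 1) !) ≡⟨ forests-closedForm m j 0 ⟩
  1 * (suc m * j + 0) !                         ≡⟨ *-identityˡ _ ⟩
  (suc m * j + 0) !                             ≡⟨ cong _! (+-identityʳ (suc m * j)) ⟩
  (suc m * j) !                                 ∎
  where open ≡-Reasoning

[a+i]!*b!*m^i≤[b+i]!*a!*d^i : ∀ {m d} a b → m ≤ d → a * m ≤ d * b →
  ∀ i → (a + i) ! * b ! * m ^ i ≤ (b + i) ! * a ! * d ^ i
[a+i]!*b!*m^i≤[b+i]!*a!*d^i {m} {d} a b m≤d am≤db zero
  rewrite +-identityʳ a | +-identityʳ b = ≤-reflexive (cong (_* 1) (*-comm (a !) (b !)))
[a+i]!*b!*m^i≤[b+i]!*a!*d^i {m} {d} a b m≤d am≤db (suc i) = begin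
  (a + suc i) ! * b ! * (m * m ^ i)                  ≡⟨ cong (λ n → n ! * b ! * (m * m ^ i)) (+-suc a i) ⟩
  suc (a + i) * (a + i) ! * b ! * (m * m ^ i)        ≡⟨ regroup (suc (a + i)) ((a + i) !) (b !) m (m ^ i) ⟩
  suc (a + i) * m * ((a + i) ! * b ! * m ^ i)        ≤⟨ *-mono-≤ factor≤ ([a+i]!*b!*m^i≤[b+i]!*a!*d^i a b m≤d am≤db i) ⟩
  d * suc (b + i) * ((b + i) ! * a ! * d ^ i)        ≡⟨ regroup′ d (suc (b + i)) ((b + i) !) (a !) (d ^ i) ⟩
  suc (b + i) * (b + i) ! * a ! * (d * d ^ i)        ≡⟨ cong (λ n → n ! * a ! * (d * d ^ i)) (+-suc b i) ⟨
  (b + suc i) ! * a ! * (d * d ^ i)                  ∎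
  where
  open ≤-Reasoning
  regroup : ∀ s x y m z → s * x * y * (m * z) ≡ s * m * (x * y * z)
  regroup = solve-∀
  regroup′ : ∀ d s x y z → d * s * (x * y * z) ≡ s * x * y * (d * z)
  regroup′ = solve-∀
  distrib₁ : ∀ a i m → suc (a + i) * m ≡ a * m + suc i * m
  distrib₁ = solve-∀
  distrib₂ : ∀ d b i → d * b + suc i * d ≡ d * suc (b + i)
  distrib₂ = solve-∀
  factor≤ : suc (a + i) * m ≤ d * suc (b + i)
  factor≤ = begin
    suc (a + i) * m       ≡⟨ distrib₁ a i m ⟩
    a * m + suc i * m     ≤⟨ +-mono-≤ am≤db (*-monoʳ-≤ (suc i) m≤d) ⟩
    d * b + suc i * d     ≡⟨ distrib₂ d b i ⟩
    d * suc (b + i)       ∎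

fussCatalan-ratio : ∀ m j → fussCatalan (suc m) (suc j) * m ^ m ≤ suc m ^ suc m * fussCatalan (suc m) j
fussCatalan-ratio m j = *-cancelʳ-≤ _ _ Z {{Z≢0}} (begin
  A * m ^ m * Z                                        ≡⟨ regroup A (m ^ m) (suc j !) V U ⟩
  A * (suc j ! * V) * U * m ^ m                        ≡⟨ cong (λ x → x * U * m ^ m) (fussCatalan-closedForm m (suc j)) ⟩
  (suc m * suc j) ! * U * m ^ m                        ≡⟨ cong (λ n → n ! * U * m ^ m) (index₁ m j) ⟩
  suc (a + m) * (a + m) ! * U * m ^ m                  ≡⟨ reassoc (suc (a + m)) ((a + m) !) U (m ^ m) ⟩
  suc (a + m) * ((a + m) ! * U * m ^ m)                ≤⟨ *-monoʳ-≤ (suc (a + m)) ([a+i]!*b!*m^i≤[b+i]!*a!*d^i a (m * j + 1) (n≤1+n m) am≤db m) ⟩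
  suc (a + m) * ((m * j + 1 + m) ! * a ! * d ^ m)      ≡⟨ cong₂ (λ x y → suc (a + m) * (x * y * d ^ m)) (cong _! (index₂ m j)) (sym (fussCatalan-closedForm m j)) ⟩
  suc (a + m) * (V * (B * (j ! * U)) * d ^ m)          ≡⟨ regroup′ m j V B (j !) U (d ^ m) ⟩
  d ^ d * B * Z                                        ∎)
  where
  open ≤-Reasoning
  d = suc m
  a = suc m * j
  A = fussCatalan d (suc j)
  B = fussCatalan d j
  U = (m * j + 1) !
  V = (m * suc j + 1) !
  Z = suc j ! * V * U
  Z≢0 : NonZero Z
  Z≢0 = m*n≢0 _ _ {{m*n≢0 _ _ {{suc j !≢0}} {{(m * suc j + 1) !≢0}}}} {{(m * j + 1) !≢0}}
  am≤db : a * m ≤ d * (m * j + 1)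
  am≤db = ≤-trans (m≤m+n (a * m) d) (≤-reflexive (distrib m j))
    where
    distrib : ∀ m j → suc m * j * m + suc m ≡ suc m * (m * j + 1)
    distrib = solve-∀
  index₁ : ∀ m j → suc m * suc j ≡ suc (suc m * j + m)
  index₁ = solve-∀
  index₂ : ∀ m j → m * j + 1 + m ≡ m * suc j + 1
  index₂ = solve-∀
  regroup : ∀ A M S V U → A * M * (S * V * U) ≡ A * (S * V) * U * M
  regroup = solve-∀
  reassoc : ∀ s x u m → s * x * u * m ≡ s * (x * u * m)
  reassoc = solve-∀
  regroup′ : ∀ m j V B X U M → suc (suc m * j + m) * (V * (B * (X * U)) * M) ≡ suc m * M * B * (suc j * X * V * U)
  regroup′ = solve-∀

ratio-iterate : ∀ (f : ℕ → ℕ) {a b} → (∀ j → f (suc j) * a ≤ b * f j) →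
  ∀ p j → f (p + j) * a ^ p ≤ b ^ p * f j
ratio-iterate f ratio zero    j = ≤-reflexive (trans (*-identityʳ (f j)) (sym (*-identityˡ (f j))))
ratio-iterate f {a} {b} ratio (suc p) j = begin
  f (suc p + j) * (a * a ^ p)   ≡⟨ *-assoc (f (suc p + j)) a (a ^ p) ⟨
  f (suc p + j) * a * a ^ p     ≤⟨ *-monoˡ-≤ (a ^ p) (ratio (p + j)) ⟩
  b * f (p + j) * a ^ p         ≡⟨ *-assoc b (f (p + j)) (a ^ p) ⟩
  b * (f (p + j) * a ^ p)       ≤⟨ *-monoʳ-≤ b (ratio-iterate f ratio p j) ⟩
  b * (b ^ p * f j)             ≡⟨ *-assoc b (b ^ p) (f j) ⟨
  b * b ^ p * f j               ∎
  where open ≤-Reasoning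

module _ {A : Set} where

  ∈-─⁺ : ∀ {x y : A} {ys} (x∈ys : x ∈ ys) → y ∈ ys → y ≢ x → y ∈ (ys ─ x∈ys)
  ∈-─⁺ (here refl)  (here y≡x)   y≢x = ⊥-elim (y≢x y≡x)
  ∈-─⁺ (here refl)  (there y∈ys) _   = y∈ys
  ∈-─⁺ (there x∈ys) (here y≡z)   _   = here y≡z
  ∈-─⁺ (there x∈ys) (there y∈ys) y≢x = there (∈-─⁺ x∈ys y∈ys y≢x)

  Unique-⊆⇒length≤ : ∀ {xs ys : List A} → Unique xs → xs ⊆ ys → length xs ≤ length ys
  Unique-⊆⇒length≤ {[]}     _              _     = z≤n
  Unique-⊆⇒length≤ {x ∷ xs} {ys} (x∉xs ∷ xs!) xs⊆ys = begin
    suc (length xs)           ≤⟨ s≤s (Unique-⊆⇒length≤ xs! xs⊆ys─x) ⟩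
    suc (length (ys ─ x∈ys))  ≡⟨ length-removeAt′ ys (index x∈ys) ⟨
    length ys                 ∎
    where
    open ≤-Reasoning
    x∈ys : x ∈ ys
    x∈ys = xs⊆ys (here refl)
    xs⊆ys─x : xs ⊆ (ys ─ x∈ys)
    xs⊆ys─x y∈xs = ∈-─⁺ x∈ys (xs⊆ys (there y∈xs)) (≢-sym (All.lookup x∉xs y∈xs))

  length-cartesianProductWith : ∀ {B C : Set} (f : A → B → C) xs ys →
    length (cartesianProductWith f xs ys) ≡ length xs * length ys
  length-cartesianProductWith f []       ys = refl
  length-cartesianProductWith f (x ∷ xs) ys = begin
    length (map (f x) ys ++ cartesianProductWith f xs ys)  ≡⟨ length-++ (map (f x) ys) ⟩
    length (map (f x) ys) + length (cartesianProductWith f xs ys)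
      ≡⟨ cong₂ _+_ (length-map (f x) ys) (length-cartesianProductWith f xs ys) ⟩
    length ys + length xs * length ys                       ∎
    where open ≡-Reasoning

  allVecs-suc : ∀ n (xs : List A) → allVecs (suc n) xs ≡ cartesianProductWith _∷_ xs (allVecs n xs)
  allVecs-suc n xs = concatMap-cons≡product xs
    where
    concatMap-cons≡product : ∀ ys → concatMap (λ y → map (y ∷_) (allVecs n xs)) ys ≡ cartesianProductWith _∷_ ys (allVecs n xs)
    concatMap-cons≡product []       = refl
    concatMap-cons≡product (y ∷ ys) = cong (map (y ∷_) (allVecs n xs) ++_) (concatMap-cons≡product ys)

  length-allVecs : ∀ n (xs : List A) → length (allVecs n xs) ≡ length xs ^ n
  length-allVecs zero    xs = refl
  length-allVecs (suc n) xs = begin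
    length (allVecs (suc n) xs)                            ≡⟨ cong length (allVecs-suc n xs) ⟩
    length (cartesianProductWith _∷_ xs (allVecs n xs))    ≡⟨ length-cartesianProductWith _∷_ xs (allVecs n xs) ⟩
    length xs * length (allVecs n xs)                      ≡⟨ cong (length xs *_) (length-allVecs n xs) ⟩
    length xs * length xs ^ n                              ∎
    where open ≡-Reasoning

  allVecs⁺ : ∀ {xs : List A} → Unique xs → ∀ n → Unique (allVecs n xs)
  allVecs⁺ xs! zero = [] ∷ []
  allVecs⁺ {xs} xs! (suc n) rewrite allVecs-suc n xs =
    Uniqueₚ.cartesianProductWith⁺ _∷_ Vecₚ.∷-injective xs! (allVecs⁺ xs! n)

  ∈-allVecs⁺ : ∀ {xs : List A} {n} {v : Vec A n} → VecAll (_∈ xs) v → v ∈ allVecs n xs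
  ∈-allVecs⁺ []                = here refl
  ∈-allVecs⁺ {xs} {suc n} (x∈xs ∷ v⊆xs) rewrite allVecs-suc n xs =
    ∈-cartesianProductWith⁺ _∷_ x∈xs (∈-allVecs⁺ v⊆xs)

take-drop-++ : ∀ {A : Set} {m n} (xs : Vec A m) (ys : Vec A n) → take m (xs ++ᵛ ys) ≡ xs × drop m (xs ++ᵛ ys) ≡ ys
take-drop-++ {m = m} xs ys = Product.map sym sym (Vecₚ.++-injective xs (take m (xs ++ᵛ ys)) (sym (Vecₚ.take++drop≡id m (xs ++ᵛ ys))))

module _ {d : ℕ} where

  internalV-++ : ∀ {m n} (ts : Vec (Tree d) m) (us : Vec (Tree d) n) →
    internalV (ts ++ᵛ us) ≡ internalV ts + internalV us
  internalV-++ []       us = refl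
  internalV-++ (t ∷ ts) us = trans (cong (internal t +_) (internalV-++ ts us)) (sym (+-assoc (internal t) _ _))

  node-injective : ∀ {ts us : Vec (Tree d) d} → node ts ≡ node us → ts ≡ us
  node-injective refl = refl

  graft : ∀ {n} → Vec (Tree d) (d + n) → Vec (Tree d) (suc n)
  graft ts = node (take d ts) ∷ drop d ts

  graft-++ : ∀ {n} (ts : Vec (Tree d) d) (us : Vec (Tree d) n) → graft (ts ++ᵛ us) ≡ node ts ∷ us
  graft-++ ts us with take-drop-++ ts us
  ... | take≡ , drop≡ = cong₂ (λ xs ys → node xs ∷ ys) take≡ drop≡

  graft-injective : ∀ {n} {ts us : Vec (Tree d) (d + n)} → graft ts ≡ graft us → ts ≡ us
  graft-injective {ts = ts} {us} eq = begin
    ts                       ≡⟨ Vecₚ.take++drop≡id d ts ⟨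
    take d ts ++ᵛ drop d ts  ≡⟨ cong₂ _++ᵛ_ (node-injective (Vecₚ.∷-injectiveˡ eq)) (Vecₚ.∷-injectiveʳ eq) ⟩
    take d us ++ᵛ drop d us  ≡⟨ Vecₚ.take++drop≡id d us ⟩
    us                       ∎
    where open ≡-Reasoning

  internalV-graft : ∀ {n} (ts : Vec (Tree d) (d + n)) → internalV (graft ts) ≡ suc (internalV ts)
  internalV-graft ts =
    cong suc (trans (sym (internalV-++ (take d ts) (drop d ts))) (cong internalV (Vecₚ.take++drop≡id d ts)))

  forestList : (n j : ℕ) → List (Vec (Tree d) n)
  forestList zero    zero    = [] ∷ []
  forestList zero    (suc j) = []
  forestList (suc n) zero    = map (leaf ∷_) (forestList n zero)
  forestList (suc n) (suc j) = map (leaf ∷_) (forestList n (suc j)) ++ map graft (forestList (d + n) j)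

  length-forestList : ∀ n j → length (forestList n j) ≡ forests d n j
  length-forestList zero    zero    = refl
  length-forestList zero    (suc j) = refl
  length-forestList (suc n) zero    = trans (length-map (leaf ∷_) (forestList n zero)) (length-forestList n zero)
  length-forestList (suc n) (suc j) = begin
    length (map (leaf ∷_) (forestList n (suc j)) ++ map graft (forestList (d + n) j))
      ≡⟨ length-++ (map (leaf ∷_) (forestList n (suc j))) ⟩
    length (map (leaf ∷_) (forestList n (suc j))) + length (map graft (forestList (d + n) j))
      ≡⟨ cong₂ _+_ (length-map (leaf ∷_) (forestList n (suc j))) (length-map graft (forestList (d + n) j)) ⟩
    length (forestList n (suc j)) + length (forestList (d + n) j)
      ≡⟨ cong₂ _+_ (length-forestList n (suc j)) (length-forestList (d + n) j) ⟩
    forests d n (suc j) + forests d (d + n) j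
      ∎
    where open ≡-Reasoning

  forestList-internalV : ∀ n j → All (λ ts → internalV ts ≡ j) (forestList n j)
  forestList-internalV zero    zero    = refl ∷ []
  forestList-internalV zero    (suc j) = []
  forestList-internalV (suc n) zero    = Allₚ.map⁺ (forestList-internalV n zero)
  forestList-internalV (suc n) (suc j) =
    Allₚ.++⁺ (Allₚ.map⁺ (forestList-internalV n (suc j)))
             (Allₚ.map⁺ (All.map (λ {ts} eq → trans (internalV-graft ts) (cong suc eq)) (forestList-internalV (d + n) j)))

  ∈-forestList⁺ : ∀ n j (ts : Vec (Tree d) n) → internalV ts ≡ j → ts ∈ forestList n j
  ∈-forestList⁺ zero    zero    []              _  = here refl
  ∈-forestList⁺ (suc n) zero    (leaf ∷ ts)     eq = ∈-map⁺ (leaf ∷_) (∈-forestList⁺ n zero ts eq)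
  ∈-forestList⁺ (suc n) (suc j) (leaf ∷ ts)     eq = ∈-++⁺ˡ (∈-map⁺ (leaf ∷_) (∈-forestList⁺ n (suc j) ts eq))
  ∈-forestList⁺ (suc n) (suc j) (node us ∷ ts) eq =
    ∈-++⁺ʳ (map (leaf ∷_) (forestList n (suc j)))
      (subst (_∈ map graft (forestList (d + n) j)) (graft-++ us ts)
        (∈-map⁺ graft (∈-forestList⁺ (d + n) j (us ++ᵛ ts) (trans (internalV-++ us ts) (suc-injective eq)))))

  forestList-unique : ∀ n j → Unique (forestList n j)
  forestList-unique zero    zero    = [] ∷ []
  forestList-unique zero    (suc j) = []
  forestList-unique (suc n) zero    = Uniqueₚ.map⁺ Vecₚ.∷-injectiveʳ (forestList-unique n zero)
  forestList-unique (suc n) (suc j) =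
    Uniqueₚ.++⁺ (Uniqueₚ.map⁺ Vecₚ.∷-injectiveʳ (forestList-unique n (suc j)))
                (Uniqueₚ.map⁺ graft-injective (forestList-unique (d + n) j))
                leaf-first≢graft
    where
    leaf-first≢graft : ∀ {ts} → ¬ (ts ∈ map (leaf ∷_) (forestList n (suc j)) × ts ∈ map graft (forestList (d + n) j))
    leaf-first≢graft (ts∈₁ , ts∈₂) with ∈-map⁻ (leaf ∷_) ts∈₁ | ∈-map⁻ graft ts∈₂
    ... | _ , _ , refl | _ , _ , eq with Vecₚ.∷-injectiveˡ eq
    ... | ()

  allTrees-unique : ∀ h → Unique (allTrees d h)
  allTrees-unique zero    = [] ∷ []
  allTrees-unique (suc h) =
    leaf∉nodes (allVecs d (allTrees d h)) ∷ Uniqueₚ.map⁺ node-injective (allVecs⁺ (allTrees-unique h) d)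
    where
    leaf∉nodes : ∀ tss → All (leaf ≢_) (map node tss)
    leaf∉nodes []        = []
    leaf∉nodes (_ ∷ tss) = (λ ()) ∷ leaf∉nodes tss

  mutual
    ∈-allTrees : ∀ h t → internal t ≤ h → t ∈ allTrees d h
    ∈-allTrees zero    leaf      _           = here refl
    ∈-allTrees (suc h) leaf      _           = here refl
    ∈-allTrees (suc h) (node ts) (s≤s ts≤h) = there (∈-map⁺ node (∈-allVecs⁺ (∈-allTreesV ts ts≤h)))

    ∈-allTreesV : ∀ {h n} (ts : Vec (Tree d) n) → internalV ts ≤ h → VecAll (_∈ allTrees d h) ts
    ∈-allTreesV []       _    = []
    ∈-allTreesV (t ∷ ts) ts≤h =
      ∈-allTrees _ t (≤-trans (m≤m+n _ _) ts≤h) ∷ ∈-allTreesV ts (≤-trans (m≤n+m _ _) ts≤h)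

  catalan-unique : ∀ k → Unique (catalan d k)
  catalan-unique k = Uniqueₚ.filter⁺ (λ t → internal t ≟ k) (allTrees-unique k)

  ∈-catalan⁺ : ∀ {k} t → internal t ≡ k → t ∈ catalan d k
  ∈-catalan⁺ t refl = ∈-filter⁺ (λ t → internal t ≟ _) (∈-allTrees _ t ≤-refl) refl

  length-catalan≤fussCatalan : ∀ k → length (catalan d k) ≤ fussCatalan d k
  length-catalan≤fussCatalan k = begin
    length (catalan d k)                 ≤⟨ Unique-⊆⇒length≤ (catalan-unique k) catalan⊆ ⟩
    length (map Vec.head (forestList 1 k)) ≡⟨ length-map Vec.head (forestList 1 k) ⟩
    length (forestList 1 k)              ≡⟨ length-forestList 1 k ⟩
    fussCatalan d k                      ∎
    where
    open ≤-Reasoning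
    catalan⊆ : catalan d k ⊆ map Vec.head (forestList 1 k)
    catalan⊆ {t} t∈ = ∈-map⁺ Vec.head (∈-forestList⁺ 1 k (t ∷ []) (trans (+-identityʳ (internal t)) (proj₂ (∈-filter⁻ (λ t → internal t ≟ k) {xs = allTrees d k} t∈))))

  place : ∀ {n} → Fin n → Tree d → Vec (Tree d) n
  place zero    t = t ∷ Vec.replicate _ leaf
  place (suc i) t = leaf ∷ place i t

  -- The tree whose internal vertices in generations 0, …, p form a path that descends
  -- into child is[g] at generation g and ends in node ts.
  spine : ∀ {p} → Vec (Fin d) p → Vec (Tree d) d → Tree d
  spine []       ts = node ts
  spine (i ∷ is) ts = node (place i (spine is ts))

  internalV-replicate-leaf : ∀ n → internalV (Vec.replicate n (leaf {d}))  ≡ 0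
  internalV-replicate-leaf zero    = refl
  internalV-replicate-leaf (suc n) = internalV-replicate-leaf n

  internalV-place : ∀ {n} (i : Fin n) t → internalV (place i t) ≡ internal t
  internalV-place {suc n} zero t = trans (cong (internal t +_) (internalV-replicate-leaf n)) (+-identityʳ _)
  internalV-place (suc i) t = internalV-place i t

  internal-spine : ∀ {p} (is : Vec (Fin d) p) ts → internal (spine is ts) ≡ p + internal (node ts)
  internal-spine []       ts = refl
  internal-spine (i ∷ is) ts = cong suc (trans (internalV-place i _) (internal-spine is ts))

  genInternalV-replicate-leaf : ∀ g n → genInternalV g (Vec.replicate n (leaf {d})) ≡ 0
  genInternalV-replicate-leaf g zero    = refl
  genInternalV-replicate-leaf g (suc n) = genInternalV-replicate-leaf g n

  genInternalV-place : ∀ g {n} (i : Fin n) t → genInternalV g (place i t) ≡ genInternal g t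
  genInternalV-place g {suc n} zero t = trans (cong (genInternal g t +_) (genInternalV-replicate-leaf g n)) (+-identityʳ _)
  genInternalV-place g (suc i) t = genInternalV-place g i t

  genInternal-spine : ∀ {p} (is : Vec (Fin d) p) ts g → g ≤ p → genInternal g (spine is ts) ≡ 1
  genInternal-spine []       ts zero    _         = refl
  genInternal-spine (i ∷ is) ts zero    _         = refl
  genInternal-spine (i ∷ is) ts (suc g) (s≤s g≤p) = trans (genInternalV-place g i _) (genInternal-spine is ts g g≤p)

  spine-good : ∀ {p} (is : Vec (Fin d) p) ts → Good p (spine is ts)
  spine-good {p} is ts = All.tabulate generation≤1
    where
    generation≤1 : ∀ {g} → g ∈ map suc (upTo p) → genInternal g (spine is ts) ≤ 1
    generation≤1 g∈ with ∈-map⁻ suc g∈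
    ... | g′ , g′∈ , refl = ≤-reflexive (genInternal-spine is ts (suc g′) (∈-upTo⁻ g′∈))

  spine≢leaf : ∀ {p} (is : Vec (Fin d) p) ts → spine is ts ≢ leaf
  spine≢leaf []       ts ()
  spine≢leaf (i ∷ is) ts ()

  place-injective : ∀ {n} (i i′ : Fin n) {t t′} → t ≢ leaf → t′ ≢ leaf → place i t ≡ place i′ t′ → i ≡ i′ × t ≡ t′
  place-injective zero    zero     _   _    eq = refl , Vecₚ.∷-injectiveˡ eq
  place-injective zero    (suc i′) t≢  _    eq = ⊥-elim (t≢ (Vecₚ.∷-injectiveˡ eq))
  place-injective (suc i) zero     _   t′≢ eq = ⊥-elim (t′≢ (sym (Vecₚ.∷-injectiveˡ eq)))
  place-injective (suc i) (suc i′) t≢  t′≢ eq with place-injective i i′ t≢ t′≢ (Vecₚ.∷-injectiveʳ eq)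
  ... | refl , t≡t′ = refl , t≡t′

  spine-injective : ∀ {p} {is is′ : Vec (Fin d) p} {ts ts′} → spine is ts ≡ spine is′ ts′ → is ≡ is′ × ts ≡ ts′
  spine-injective {is = []}     {[]}       eq = refl , node-injective eq
  spine-injective {is = i ∷ is} {i′ ∷ is′} {ts} {ts′} eq
    with place-injective i i′ (spine≢leaf is ts) (spine≢leaf is′ ts′) (node-injective eq)
  ... | refl , eq′ with spine-injective {is = is} {is′} eq′
  ... | refl , refl = refl , refl

  spineList : ℕ → ℕ → List (Tree d)
  spineList p j = cartesianProductWith spine (allVecs p (allFin d)) (forestList d j)

  length-spineList : ∀ p j → length (spineList p j) ≡ d ^ p * fussCatalan d (suc j)
  length-spineList p j = begin
    length (spineList p j)                                        ≡⟨ length-cartesianProductWith spine (allVecs p (allFin d)) (forestList d j) ⟩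
    length (allVecs p (allFin d)) * length (forestList d j)       ≡⟨ cong₂ _*_ (length-allVecs p (allFin d)) (length-forestList d j) ⟩
    length (allFin d) ^ p * forests d d j                         ≡⟨ cong₂ (λ n f → n ^ p * f) (length-tabulate {n = d} (λ i → i)) (sym (fussCatalan-suc d j)) ⟩
    d ^ p * fussCatalan d (suc j)                                 ∎
    where open ≡-Reasoning

  spineList⊆good : ∀ p j → spineList p j ⊆ filter (good? p) (catalan d (suc p + j))
  spineList⊆good p j t∈ with ∈-cartesianProductWith⁻ spine (allVecs p (allFin d)) (forestList d j) t∈
  ... | is , ts , _ , ts∈ , refl =
    ∈-filter⁺ (good? p) (∈-catalan⁺ (spine is ts) internal≡) (spine-good is ts)
    where
    internal≡ : internal (spine is ts) ≡ suc p + j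
    internal≡ = begin
      internal (spine is ts)       ≡⟨ internal-spine is ts ⟩
      p + suc (internalV ts)       ≡⟨ cong (λ n → p + suc n) (All.lookup (forestList-internalV d j) ts∈) ⟩
      p + suc j                    ≡⟨ +-suc p j ⟩
      suc p + j                    ∎
      where open ≡-Reasoning

  good-lowerBound : ∀ p j → d ^ p * fussCatalan d (suc j) ≤ length (filter (good? p) (catalan d (suc p + j)))
  good-lowerBound p j = subst (_≤ length (filter (good? p) (catalan d (suc p + j)))) (length-spineList p j)
    (Unique-⊆⇒length≤ spineList-unique (spineList⊆good p j))
    where
    spineList-unique : Unique (spineList p j)
    spineList-unique = Uniqueₚ.cartesianProductWith⁺ spine spine-injective
      (allVecs⁺ (Uniqueₚ.allFin⁺ d) p) (forestList-unique d j)

catalan*N!≤good*expNum : ∀ m o p → .{{NonZero m}} → let d = suc m; k = suc p + o; N = m * p in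
  length (catalan d k) * N ! ≤ length (filter (good? p) (catalan d k)) * expNum p N
catalan*N!≤good*expNum m o p = *-cancelˡ-≤ (m ^ N) {{m^n≢0 m N}} (begin
  m ^ N * (C * N !)                  ≤⟨ *-monoʳ-≤ (m ^ N) (*-monoˡ-≤ (N !) (length-catalan≤fussCatalan {d} k)) ⟩
  m ^ N * (T (suc p + o) * N !)      ≡⟨ cong₂ (λ j x → x * (T j * N !)) (+-suc p o) (^-*-assoc m m p) ⟨
  (m ^ m) ^ p * (T (p + suc o) * N !) ≡⟨ regroup ((m ^ m) ^ p) (T (p + suc o)) (N !) ⟩
  T (p + suc o) * (m ^ m) ^ p * N !  ≤⟨ *-monoˡ-≤ (N !) (ratio-iterate T (fussCatalan-ratio m) p (suc o)) ⟩
  (d ^ d) ^ p * T (suc o) * N !      ≡⟨ cong (λ x → x * T (suc o) * N !) (trans (^-*-assoc d d p) (^-distribˡ-+-* d p N)) ⟩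
  d ^ p * d ^ N * T (suc o) * N !    ≡⟨ regroup′ (d ^ p) (d ^ N) (T (suc o)) (N !) ⟩
  d ^ p * T (suc o) * (d ^ N * N !)  ≤⟨ *-monoʳ-≤ (d ^ p * T (suc o)) ([1+m]^N*N!≤m^N*expNum m p) ⟩
  d ^ p * T (suc o) * (m ^ N * E)    ≤⟨ *-monoˡ-≤ (m ^ N * E) (good-lowerBound {d} p o) ⟩
  G * (m ^ N * E)                    ≡⟨ x∙yz≈y∙xz G (m ^ N) E ⟩
  m ^ N * (G * E)                    ∎)
  where
  open ≤-Reasoning
  d = suc m
  k = suc p + o
  N = m * p
  T = fussCatalan d
  C = length (catalan d k)
  G = length (filter (good? p) (catalan d k))
  E = expNum p N
  regroup : ∀ x t f → x * (t * f) ≡ t * x * f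
  regroup = solve-∀
  regroup′ : ∀ a b t f → a * b * t * f ≡ a * t * (b * f)
  regroup′ = solve-∀

-- The argument does not use 1 ≤ p.
corollary5p3 : (d k p : ℕ) → 2 ≤ d → 1 ≤ p → p < k →
    ∃ λ N → length (catalan d k) * N ! ≤ length (filter (good? p) (catalan d k)) * expNum p N
corollary5p3 (suc (suc m)) k p (s≤s (s≤s z≤n)) _ p<k with m≤n⇒∃[o]m+o≡n p<k
... | o , refl = suc m * p , catalan*N!≤good*expNum (suc m) o p
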